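{- Let $q$ be a prime power, $m\ge 2$, $r\ge 1$, and let $G$ be the additive group of the finite field $\mathrm{GF}(q)$. If there exists an $(m+r)$-arc in the projective space $\mathrm{PG}(m-1,q)$, then $T(m,G)\ge r$.
   Context: A $k$-arc in $\mathrm{PG}(m-1,q)$ is a set of $k$ points (one-dimensional subspaces of $\mathrm{GF}(q)^m$) such that any $m$ of them span the space. For a set $A$ and $\Omega=A^m$, the Cartesian lattice of dimension $m$ consists of the partitions $Q_J$ ($J\subseteq\{1,\dots,m\}$) of $\Omega$ where two $m$-tuples are in the same part iff they agree in all coordinates outside $J$; its minimal non-trivial elements are $Q_{\{1\}},\dots,Q_{\{m\}}$. For a group $K$ let $K_i\le K^m$ ($1\le i\le m$) be the $i$th coordinate subgroup and $K_{m+1}=\{(g,\dots,g):g\in K\}$. Say that $m+1$ partitions of a set $\Omega$ define a group isomorphic to $K$ if there is a bijection $\Omega\to K^m$ carrying them (in some order) to the right coset partitions of $K_1,\dots,K_{m+1}$ (for $m=2$ this means the Latin square formed by the three partitions is isotopic to the Cayley table of $K$). $T(m,G)$ is the maximum $r$ such that there exist $m+r$ partitions of a set of cardinality $|G|^m$, any $m$ of which are the minimal non-trivial elements of an $m$-dimensional Cartesian lattice, and any $m+1$ of which define a group isomorphic to $G$. -}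

module Defs where

open import Level using (0ℓ)
open import Data.Nat as ℕ using (ℕ; suc; _^_; _≤_)
open import Data.Nat.Primality using (Prime)
open import Data.Fin using (Fin)
open import Data.Product using (Σ; ∃; ∃-syntax; _×_)
open import Data.Sum using (_⊎_; inj₁; inj₂)
open import Data.Unit using (⊤)
open import Relation.Nullary using (¬_)
open import Relation.Binary using (Rel; Setoid; IsEquivalence)
open import Relation.Binary.PropositionalEquality using (_≡_)
import Relation.Binary.PropositionalEquality as ≡
open import Function.Definitions using (Injective)
open import Function.Bundles using (Inverse)
open import Algebra.Bundles using (CommutativeRing)
import Algebra.Properties.Monoid.Sum as MonoidSum
import Data.Vec.Functional.Relation.Binary.Equality.Setoid as VecEq

IsPrimePower : ℕ → Set
IsPrimePower q = ∃[ p ] ∃[ k ] (Prime p × q ≡ p ^ suc k)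

-- Fields (agda-stdlib has no Field bundle): a commutative ring with
-- 0 ≠ 1 in which every nonzero element has a multiplicative inverse.

record Field : Set₁ where
  field
    commutativeRing : CommutativeRing 0ℓ 0ℓ
  open CommutativeRing commutativeRing public
  field
    0≉1     : ¬ (0# ≈ 1#)
    inverse : ∀ x → ¬ (x ≈ 0#) → ∃[ y ] (x * y ≈ 1#)

HasCardinality : Field → ℕ → Set
HasCardinality F q = Inverse (≡.setoid (Fin q)) (Field.setoid F)

-- Injective choice of n indices out of k ("any n of them")

Choice : ℕ → ℕ → Set
Choice n k = Σ (Fin n → Fin k) (λ s → Injective {A = Fin n} {B = Fin k} _≡_ _≡_ s)

-- Arcs in PG(m-1, q), points represented by nonzero vectors of F^m

module _ (F : Field) where
  open Field F
  open MonoidSum +-monoid using (sum)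

  Vect : ℕ → Set
  Vect m = Fin m → Carrier

  _≈ᵥ_ : ∀ {m} → Rel (Vect m) 0ℓ
  u ≈ᵥ v = ∀ i → u i ≈ v i

  Nonzero : ∀ {m} → Vect m → Set
  Nonzero v = ¬ (∀ i → v i ≈ 0#)

  SamePoint : ∀ {m} → Vect m → Vect m → Set
  SamePoint v w = ∃[ c ] (∀ i → v i ≈ c * w i)

  Spans : ∀ {n m} → (Fin n → Vect m) → Set
  Spans {n} {m} u = ∀ (w : Vect m) →
    Σ (Fin n → Carrier) λ c → (∀ (i : Fin m) → w i ≈ sum (λ l → c l * u l i))

  record Arc (m k : ℕ) : Set where
    field
      point    : Fin k → Vect m
      nonzero  : ∀ i → Nonzero (point i)
      distinct : ∀ i j → ¬ (i ≡ j) → ¬ SamePoint (point i) (point j)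
      spanning : ∀ (s : Choice m k) → Spans (λ l → point (Σ.proj₁ s l))

record Partition (Ω : Set) : Set₁ where
  field
    _∼_   : Rel Ω 0ℓ
    isEquivalence : IsEquivalence _∼_

SamePartition : ∀ {Ω} → Rel Ω 0ℓ → Rel Ω 0ℓ → Set
SamePartition {Ω} R S = ∀ (x y : Ω) → (R x y → S x y) × (S x y → R x y)

SameSetOfPartitions : ∀ {Ω I J : Set} → (I → Rel Ω 0ℓ) → (J → Rel Ω 0ℓ) → Set
SameSetOfPartitions {I = I} {J} P Q =
  (∀ (i : I) → ∃[ j ] SamePartition (P i) (Q j)) ×
  (∀ (j : J) → ∃[ i ] SamePartition (P i) (Q j))

CartQ : ∀ (A : Set) (m : ℕ) → Fin m → Rel (Fin m → A) 0ℓ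
CartQ A m i x y = ∀ j → ¬ (j ≡ i) → x j ≡ y j

-- the partitions P 0 … P (m-1) of Ω are the minimal non-trivial elements
-- of an m-dimensional Cartesian lattice on Ω: there is a set A and a
-- bijection φ : Ω → A^m carrying them (in some order) to Q_{1},…,Q_{m}
IsCartesianMinimal : ∀ {Ω : Set} (m : ℕ) → (Fin m → Rel Ω 0ℓ) → Set₁
IsCartesianMinimal {Ω} m P =
  ∃[ A ] Σ (Inverse (≡.setoid Ω) (VecEq.≋-setoid (≡.setoid A) m)) λ φ →
    SameSetOfPartitions P
      (λ i x y → CartQ A m i (Inverse.to φ x) (Inverse.to φ y))

-- The subgroups K_1,…,K_m, K_{m+1} of K^m, for K the additive group of
-- a field F; index inj₁ i is K_i (coordinate subgroup), inj₂ _ is the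
-- diagonal K_{m+1}.

module _ (F : Field) where
  open Field F

  SubK : (m : ℕ) → (Fin m ⊎ ⊤) → (Fin m → Carrier) → Set
  SubK m (inj₁ i) h = ∀ j → ¬ (j ≡ i) → h j ≈ 0#
  SubK m (inj₂ _) h = ∃[ g ] (∀ j → h j ≈ g)

  RightCoset : (m : ℕ) → (Fin m ⊎ ⊤) → Rel (Fin m → Carrier) 0ℓ
  RightCoset m j x y = ∃[ h ] (SubK m j h × (∀ k → y k ≈ h k + x k))

  DefinesGroup : ∀ {Ω : Set} (m : ℕ) → (Fin (suc m) → Rel Ω 0ℓ) → Set
  DefinesGroup {Ω} m P =
    Σ (Inverse (≡.setoid Ω) (VecEq.≋-setoid setoid m)) λ φ →
      SameSetOfPartitions P
        (λ j x y → RightCoset m j (Inverse.to φ x) (Inverse.to φ y))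

  -- there exist m + r partitions of a set of cardinality |F|^m
  -- (here Fin (q ^ m)), any m of which are the minimal elements of an
  -- m-dim Cartesian lattice, and any m+1 of which define a group ≅ (F,+)
  HasPartitionSystem : (q m r : ℕ) → Set₁
  HasPartitionSystem q m r =
    Σ (Fin (m ℕ.+ r) → Partition (Fin (q ^ m))) λ P →
      (∀ (s : Choice m (m ℕ.+ r)) →
         IsCartesianMinimal m (λ l → Partition._∼_ (P (Σ.proj₁ s l)))) ×
      (∀ (t : Choice (suc m) (m ℕ.+ r)) →
         DefinesGroup m (λ l → Partition._∼_ (P (Σ.proj₁ t l))))

  -- T(m, G) ≥ r, where T(m,G) is the maximum such r
  TAtLeast : (q m r : ℕ) → Set₁
  TAtLeast q m r = ∃[ r′ ] (r ≤ r′ × HasPartitionSystem q m r′)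

-- Identify the underlying set of size q^m with the vector space F^m and let
-- the i-th partition be the set of cosets of the line spanned by the i-th
-- point of the arc. Any m points of the arc form a basis, and in
-- coordinates with respect to it these cosets are exactly the fibres of the
-- coordinate projections: a Cartesian lattice. Any m+1 points form a circuit,
-- so the first one has only nonzero coordinates with respect to the others;
-- rescaling the basis makes it the all-ones vector, and then the m+1 coset
-- partitions are those of the coordinate subgroups and the diagonal of F^m.
module Submission where

open import Level using (0ℓ)
open import Data.Nat as ℕ using (ℕ)
open import Data.Nat.Properties using (1+n≰n; ≤-refl)
open import Data.Fin using (Fin; zero; suc; combine; funToFin; finToFun; punchIn; punchOut; _≟_)
open import Data.Fin.Properties
  using (funToFin-finToFin; finToFun-funToFin; injective⇒≤; punchOut-injective;
         punchIn-injective; punchInᵢ≢i; punchIn-punchOut)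
open import Data.Product using (∃-syntax; _×_; _,_; proj₁; proj₂)
open import Data.Sum using (_⊎_; inj₁; inj₂)
open import Data.Unit using (⊤; tt)
open import Data.Empty using (⊥-elim)
open import Function.Base using (_∘_; _on_)
open import Function.Bundles using (Inverse; Injection; _⇔_; mk⇔; Equivalence)
open import Function.Definitions using (Injective; Congruent)
open import Function.Properties.Inverse using (Inverse⇒Injection)
open import Function.Construct.Composition using (_⇔-∘_)
import Function.Construct.Composition as Composition
import Function.Construct.Symmetry as Symmetry
open import Relation.Nullary using (¬_; yes; no)
open import Relation.Binary using (Rel; Setoid; IsEquivalence)
import Relation.Binary.Construct.On as On
open import Relation.Binary.PropositionalEquality as ≡ using (_≡_; cong; cong₂)
open import Data.Vec.Functional.Relation.Binary.Equality.Setoid using (≋-setoid)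

open import Defs

funToFin-cong : ∀ {m n} {f g : Fin m → Fin n} → (∀ i → f i ≡ g i) → funToFin f ≡ funToFin g
funToFin-cong {ℕ.zero}  _   = ≡.refl
funToFin-cong {ℕ.suc m} f≗g = cong₂ combine (f≗g zero) (funToFin-cong (f≗g ∘ suc))

finToFun-inverse : ∀ q m → Inverse (≡.setoid (Fin (q ℕ.^ m))) (≋-setoid (≡.setoid (Fin q)) m)
finToFun-inverse q m = record
  { to        = finToFun
  ; from      = funToFin
  ; to-cong   = λ { ≡.refl i → ≡.refl }
  ; from-cong = funToFin-cong
  ; inverse   = (λ {f} {x} x≡ i → ≡.trans (cong (λ z → finToFun z i) x≡) (finToFun-funToFin f i))
              , (λ {x} {f} f≋ → ≡.trans (funToFin-cong f≋) (funToFin-finToFin {m} {q} x))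
  }

pointwise-inverse : ∀ {S T : Setoid 0ℓ 0ℓ} m → Inverse S T → Inverse (≋-setoid S m) (≋-setoid T m)
pointwise-inverse m I = record
  { to        = λ v i → to (v i)
  ; from      = λ v i → from (v i)
  ; to-cong   = λ v≋ i → to-cong (v≋ i)
  ; from-cong = λ v≋ i → from-cong (v≋ i)
  ; inverse   = (λ v≋ i → inverseˡ (v≋ i)) , (λ v≋ i → inverseʳ (v≋ i))
  }
  where open Inverse I

-- A second preimage z of f x, besides g (f x), lies outside the image of g,
-- so g would inject Fin (1 + n) into Fin n.
Fin-section⇒injective : ∀ {n} (f g : Fin n → Fin n) → (∀ y → f (g y) ≡ y) → Injective _≡_ _≡_ f
Fin-section⇒injective {ℕ.suc n} f g fg {x} {x′} fx≡fx′ with x ≟ x′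
... | yes x≡x′ = x≡x′
... | no  x≢x′ = ⊥-elim (1+n≰n (injective⇒≤ g′-injective))
  where
  second-preimage : ∃[ z ] (¬ z ≡ g (f x) × f z ≡ f x)
  second-preimage with x ≟ g (f x)
  ... | yes x≡gfx = x′ , (λ x′≡gfx → x≢x′ (≡.trans x≡gfx (≡.sym x′≡gfx))) , ≡.sym fx≡fx′
  ... | no  x≢gfx = x , x≢gfx , ≡.refl

  z : Fin (ℕ.suc n)
  z = proj₁ second-preimage

  g-misses-z : ∀ w → ¬ z ≡ g w
  g-misses-z w z≡gw = proj₁ (proj₂ second-preimage) (≡.trans z≡gw (cong g w≡fx))
    where
    w≡fx : w ≡ f x
    w≡fx = ≡.trans (≡.sym (fg w)) (≡.trans (cong f (≡.sym z≡gw)) (proj₂ (proj₂ second-preimage)))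

  g′ : Fin (ℕ.suc n) → Fin n
  g′ w = punchOut (g-misses-z w)

  g′-injective : Injective _≡_ _≡_ g′
  g′-injective {a} {b} g′a≡g′b =
    ≡.trans (≡.sym (fg a)) (≡.trans (cong f (punchOut-injective (g-misses-z a) (g-misses-z b) g′a≡g′b)) (fg b))

finite-section⇒injective : ∀ {n} {S : Setoid 0ℓ 0ℓ} → Inverse (≡.setoid (Fin n)) S →
  let open Setoid S in
  (f g : Carrier → Carrier) → Congruent _≈_ _≈_ f → (∀ y → f (g y) ≈ y) → Injective _≈_ _≈_ f
finite-section⇒injective {n} {S} E f g f-cong fg {x} {x′} fx≈fx′ =
  trans (sym (strictlyInverseˡ x)) (trans (to-cong fromx≡fromx′) (strictlyInverseˡ x′))
  where
  open Setoid S
  open Inverse E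
  f′ g′ : Fin n → Fin n
  f′ i = from (f (to i))
  g′ i = from (g (to i))

  f′∘g′≡id : ∀ i → f′ (g′ i) ≡ i
  f′∘g′≡id i = ≡.trans (from-cong (trans (f-cong (strictlyInverseˡ _)) (fg (to i)))) (strictlyInverseʳ i)

  f′∘from : ∀ y → f′ (from y) ≡ from (f y)
  f′∘from y = from-cong (f-cong (strictlyInverseˡ y))

  fromx≡fromx′ : from x ≡ from x′
  fromx≡fromx′ = Fin-section⇒injective f′ g′ f′∘g′≡id
    (≡.trans (f′∘from x) (≡.trans (from-cong fx≈fx′) (≡.sym (f′∘from x′))))

module VectorSpace (F : Field) where
  open Field F hiding (zero)
  open import Algebra.Properties.Monoid.Sum +-monoid using (sum; sum-cong-≋; sum-replicate-zero)
  open import Algebra.Properties.CommutativeMonoid.Sum +-commutativeMonoid using (sum-remove; ∑-distrib-+)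
  open import Algebra.Properties.Semiring.Sum semiring using (*-distribˡ-sum)
  open import Algebra.Properties.Ring ring using (-1*x≈-x)
  open import Algebra.Properties.Group +-group using (//-rightDividesˡ)
  open import Relation.Binary.Reasoning.Setoid setoid

  1≉0 : ¬ 1# ≈ 0#
  1≉0 1≈0 = 0≉1 (sym 1≈0)

  invertible⇒≉0 : ∀ {a b} → a * b ≈ 1# → ¬ a ≈ 0#
  invertible⇒≉0 {a} {b} ab≈1 a≈0 = 1≉0 (trans (sym ab≈1) (trans (*-congʳ a≈0) (zeroˡ b)))

  *-cancelʳ-inverse : ∀ x a b → a * b ≈ 1# → x * b * a ≈ x
  *-cancelʳ-inverse x a b ab≈1 = begin
    x * b * a   ≈⟨ *-assoc x b a ⟩
    x * (b * a) ≈⟨ *-congˡ (trans (*-comm b a) ab≈1) ⟩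
    x * 1#      ≈⟨ *-identityʳ x ⟩
    x           ∎

  infix 4 _≋_ _∼_mod⟨_⟩
  infixl 6 _+ᵥ_
  infixl 7 _·ᵥ_

  _≋_ : ∀ {m} → Rel (Vect F m) 0ℓ
  _≋_ = _≈ᵥ_ F

  _+ᵥ_ : ∀ {m} → Vect F m → Vect F m → Vect F m
  (u +ᵥ v) k = u k + v k

  _·ᵥ_ : ∀ {m} → Carrier → Vect F m → Vect F m
  (c ·ᵥ v) k = c * v k

  unit : ∀ {m} → Fin m → Vect F m
  unit l j with j ≟ l
  ... | yes _ = 1#
  ... | no  _ = 0#

  unit-self : ∀ {m} (l : Fin m) → unit l l ≈ 1#
  unit-self l with l ≟ l
  ... | yes _   = refl
  ... | no  l≢l = ⊥-elim (l≢l ≡.refl)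

  unit-other : ∀ {m} (l j : Fin m) → ¬ j ≡ l → unit l j ≈ 0#
  unit-other l j j≢l with j ≟ l
  ... | yes j≡l = ⊥-elim (j≢l j≡l)
  ... | no  _   = refl

  lincomb : ∀ {n m} → (Fin n → Vect F m) → Vect F n → Vect F m
  lincomb w c k = sum (λ l → c l * w l k)

  lincomb-cong : ∀ {n m} (w : Fin n → Vect F m) {c c′} → c ≋ c′ → lincomb w c ≋ lincomb w c′
  lincomb-cong w c≋c′ k = sum-cong-≋ (λ l → *-congʳ (c≋c′ l))

  lincomb-linear : ∀ {n m} (w : Fin n → Vect F m) a u x →
    lincomb w (a ·ᵥ u +ᵥ x) ≋ a ·ᵥ lincomb w u +ᵥ lincomb w x
  lincomb-linear w a u x k = begin
    sum (λ l → (a * u l + x l) * w l k)             ≈⟨ sum-cong-≋ (λ l → distribʳ (w l k) (a * u l) (x l)) ⟩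
    sum (λ l → a * u l * w l k + x l * w l k)       ≈⟨ ∑-distrib-+ (λ l → a * u l * w l k) (λ l → x l * w l k) ⟩
    sum (λ l → a * u l * w l k) + lincomb w x k     ≈⟨ +-congʳ (sum-cong-≋ (λ l → *-assoc a (u l) (w l k))) ⟩
    sum (λ l → a * (u l * w l k)) + lincomb w x k   ≈⟨ +-congʳ (sym (*-distribˡ-sum a (λ l → u l * w l k))) ⟩
    a * lincomb w u k + lincomb w x k               ∎

  lincomb-zero : ∀ {n m} (w : Fin n → Vect F m) → lincomb w (λ _ → 0#) ≋ (λ _ → 0#)
  lincomb-zero {n} w k = trans (sum-cong-≋ (λ l → zeroˡ (w l k))) (sum-replicate-zero n)

  lincomb-unit : ∀ {n m} (w : Fin n → Vect F m) l → lincomb w (unit l) ≋ w l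
  lincomb-unit {ℕ.suc n} w l k = begin
    lincomb w (unit l) k                                  ≈⟨ sum-remove {i = l} (λ j → unit l j * w j k) ⟩
    unit l l * w l k + sum (λ j → unit l (punchIn l j) * w (punchIn l j) k)
                                                          ≈⟨ +-cong (*-congʳ (unit-self l)) others≈0 ⟩
    1# * w l k + 0#                                       ≈⟨ trans (+-identityʳ _) (*-identityˡ _) ⟩
    w l k                                                 ∎
    where
    others≈0 : sum (λ j → unit l (punchIn l j) * w (punchIn l j) k) ≈ 0#
    others≈0 = trans (sum-cong-≋ (λ j → trans (*-congʳ (unit-other l _ (punchInᵢ≢i l j))) (zeroˡ _)))
                     (sum-replicate-zero n)

  _∼_mod⟨_⟩ : ∀ {m} → Vect F m → Vect F m → Vect F m → Set
  x ∼ y mod⟨ v ⟩ = ∃[ c ] (y ≋ c ·ᵥ v +ᵥ x)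

  mod-isEquivalence : ∀ {m} (v : Vect F m) → IsEquivalence (λ x y → x ∼ y mod⟨ v ⟩)
  mod-isEquivalence v = record
    { refl  = λ {x} → 0# , λ k → sym (trans (+-congʳ (zeroˡ (v k))) (+-identityˡ (x k)))
    ; sym   = λ {x} {y} (c , y≋) → - c , λ k → sym (begin
        - c * v k + y k           ≈⟨ +-congˡ (y≋ k) ⟩
        - c * v k + (c * v k + x k) ≈⟨ sym (+-assoc _ _ _) ⟩
        (- c * v k + c * v k) + x k ≈⟨ +-congʳ (sym (distribʳ (v k) (- c) c)) ⟩
        (- c + c) * v k + x k     ≈⟨ +-congʳ (trans (*-congʳ (-‿inverseˡ c)) (zeroˡ (v k))) ⟩
        0# + x k                  ≈⟨ +-identityˡ (x k) ⟩
        x k                       ∎)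
    ; trans = λ {x} {y} {z} (c , y≋) (c′ , z≋) → c′ + c , λ k → begin
        z k                       ≈⟨ z≋ k ⟩
        c′ * v k + y k            ≈⟨ +-congˡ (y≋ k) ⟩
        c′ * v k + (c * v k + x k) ≈⟨ sym (+-assoc _ _ _) ⟩
        (c′ * v k + c * v k) + x k ≈⟨ +-congʳ (sym (distribʳ (v k) c′ c)) ⟩
        (c′ + c) * v k + x k      ∎
    }

  mod-cong : ∀ {m} {v v′ x y : Vect F m} → v ≋ v′ → x ∼ y mod⟨ v ⟩ ⇔ x ∼ y mod⟨ v′ ⟩
  mod-cong v≋v′ = mk⇔
    (λ (c , y≋) → c , λ k → trans (y≋ k) (+-congʳ (*-congˡ (v≋v′ k))))
    (λ (c , y≋) → c , λ k → trans (y≋ k) (+-congʳ (*-congˡ (sym (v≋v′ k)))))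

  record LinearEquiv (m : ℕ) : Set where
    field
      iso       : Inverse (≋-setoid setoid m) (≋-setoid setoid m)
    open Inverse iso public using (to; to-cong)
    field
      to-linear : ∀ a u x → to (a ·ᵥ u +ᵥ x) ≋ a ·ᵥ to u +ᵥ to x

    to-injective : Injective _≋_ _≋_ to
    to-injective = Injection.injective (Inverse⇒Injection iso)

  open LinearEquiv public using (to)

  infixr 9 _∘ₗ_
  _∘ₗ_ : ∀ {m} → LinearEquiv m → LinearEquiv m → LinearEquiv m
  M ∘ₗ L = record
    { iso       = Composition.inverse (LinearEquiv.iso L) (LinearEquiv.iso M)
    ; to-linear = λ a u x k →
        trans (LinearEquiv.to-cong M (LinearEquiv.to-linear L a u x) k) (LinearEquiv.to-linear M a _ _ k)
    }

  mod-transport : ∀ {m} (L : LinearEquiv m) {v x y} → x ∼ y mod⟨ v ⟩ ⇔ to L x ∼ to L y mod⟨ to L v ⟩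
  mod-transport L {v} {x} {y} = mk⇔
    (λ (c , y≋) → c , λ k → trans (L.to-cong y≋ k) (L.to-linear c v x k))
    (λ (c , Ly≋) → c , L.to-injective (λ k → trans (Ly≋ k) (sym (L.to-linear c v x k))))
    where module L = LinearEquiv L

  scaling : ∀ {m} (c c⁻¹ : Vect F m) → (∀ k → c k * c⁻¹ k ≈ 1#) → LinearEquiv m
  scaling c c⁻¹ cc⁻¹≈1 = record
    { iso = record
      { to        = λ x k → c k * x k
      ; from      = λ y k → c⁻¹ k * y k
      ; to-cong   = λ x≋ k → *-congˡ (x≋ k)
      ; from-cong = λ y≋ k → *-congˡ (y≋ k)
      ; inverse   = (λ {y} y≋ k → trans (*-congˡ (y≋ k)) (cancel (c k) (c⁻¹ k) (y k) (cc⁻¹≈1 k)))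
                  , (λ {x} x≋ k → trans (*-congˡ (x≋ k))
                        (cancel (c⁻¹ k) (c k) (x k) (trans (*-comm _ _) (cc⁻¹≈1 k))))
      }
    ; to-linear = λ a u x k → begin
        c k * (a * u k + x k)     ≈⟨ distribˡ (c k) (a * u k) (x k) ⟩
        c k * (a * u k) + c k * x k ≈⟨ +-congʳ (trans (sym (*-assoc _ _ _))
                                        (trans (*-congʳ (*-comm (c k) a)) (*-assoc _ _ _))) ⟩
        a * (c k * u k) + c k * x k ∎
    }
    where
    cancel : ∀ a b y → a * b ≈ 1# → a * (b * y) ≈ y
    cancel a b y ab≈1 = trans (sym (*-assoc a b y)) (trans (*-congʳ ab≈1) (*-identityˡ y))

  mod-supported⇔coordinateCoset : ∀ {m} {a : Vect F m} l → ¬ a l ≈ 0# → (∀ j → ¬ j ≡ l → a j ≈ 0#) →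
    ∀ {x y} → x ∼ y mod⟨ a ⟩ ⇔ RightCoset F m (inj₁ l) x y
  mod-supported⇔coordinateCoset {a = a} l al≉0 a-supported = mk⇔
    (λ (c , y≋) → c ·ᵥ a , (λ j j≢l → trans (*-congˡ (a-supported j j≢l)) (zeroʳ c)) , y≋)
    (λ (h , h-supported , y≋) → h l * a⁻¹ , λ k → trans (y≋ k) (+-congʳ (h≋ h h-supported k)))
    where
    a⁻¹ : Carrier
    a⁻¹ = proj₁ (inverse (a l) al≉0)

    h≋ : ∀ h → (∀ j → ¬ j ≡ l → h j ≈ 0#) → h ≋ (h l * a⁻¹) ·ᵥ a
    h≋ h h-supported k with k ≟ l
    ... | yes ≡.refl = sym (*-cancelʳ-inverse (h k) (a k) a⁻¹ (proj₂ (inverse (a l) al≉0)))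
    ... | no  k≢l    = trans (h-supported k k≢l) (sym (trans (*-congˡ (a-supported k k≢l)) (zeroʳ _)))

  mod-ones⇔diagonalCoset : ∀ {m} {a : Vect F m} → (∀ k → a k ≈ 1#) →
    ∀ {x y} → x ∼ y mod⟨ a ⟩ ⇔ RightCoset F m (inj₂ tt) x y
  mod-ones⇔diagonalCoset {a = a} a≈1 = mk⇔
    (λ (c , y≋) → c ·ᵥ a , (c , λ j → c*a≈c c j) , y≋)
    (λ (h , (g , h≈g) , y≋) → g , λ k → trans (y≋ k) (+-congʳ (trans (h≈g k) (sym (c*a≈c g k)))))
    where
    c*a≈c : ∀ c k → c * a k ≈ c
    c*a≈c c k = trans (*-congˡ (a≈1 k)) (*-identityʳ c)

  AgreeOff : ∀ {m} → Fin m → Rel (Vect F m) 0ℓ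
  AgreeOff l x y = ∀ j → ¬ j ≡ l → x j ≈ y j

  coordinateCoset⇔agreeOff : ∀ {m} (l : Fin m) {x y} → RightCoset F m (inj₁ l) x y ⇔ AgreeOff l x y
  coordinateCoset⇔agreeOff l {x} {y} = mk⇔
    (λ (h , h-supported , y≋) j j≢l → sym (trans (y≋ j) (trans (+-congʳ (h-supported j j≢l)) (+-identityˡ (x j)))))
    (λ x≈y → (λ k → y k + - x k)
           , (λ j j≢l → trans (+-congʳ (sym (x≈y j j≢l))) (-‿inverseʳ (x j)))
           , (λ k → sym (//-rightDividesˡ (x k) (y k))))

  module Finite {q} (ψ : HasCardinality F q) where
    module ψ = Inverse ψ

    encoding : ∀ m → Inverse (≡.setoid (Fin (q ℕ.^ m))) (≋-setoid setoid m)
    encoding m = Composition.inverse (finToFun-inverse q m) (pointwise-inverse m ψ)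

    encode : ∀ {m} → Fin (q ℕ.^ m) → Vect F m
    encode {m} = Inverse.to (encoding m)

    agreeOff⇔cartesian : ∀ {m} (l : Fin m) {x y} → AgreeOff l x y ⇔ CartQ (Fin q) m l (ψ.from ∘ x) (ψ.from ∘ y)
    agreeOff⇔cartesian l = mk⇔
      (λ x≈y j j≢l → ψ.from-cong (x≈y j j≢l))
      (λ fx≡fy j j≢l → Injection.injective (Inverse⇒Injection (Symmetry.inverse ψ)) (fx≡fy j j≢l))

    module Coordinates {m} (w : Fin m → Vect F m) (w-spans : Spans F w) where
      coordinates : Vect F m → Vect F m
      coordinates x = proj₁ (w-spans x)

      lincomb-coordinates : ∀ x → lincomb w (coordinates x) ≋ x
      lincomb-coordinates x k = sym (proj₂ (w-spans x) k)

      lincomb-injective : Injective _≋_ _≋_ (lincomb w)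
      lincomb-injective = finite-section⇒injective (encoding m) (lincomb w) coordinates
        (lincomb-cong w) lincomb-coordinates

      coordinate-equiv : LinearEquiv m
      coordinate-equiv = record
        { iso = record
          { to        = coordinates
          ; from      = lincomb w
          ; to-cong   = λ x≋ → lincomb-injective (λ k → trans (lincomb-coordinates _ k)
                                  (trans (x≋ k) (sym (lincomb-coordinates _ k))))
          ; from-cong = lincomb-cong w
          ; inverse   = (λ {x} x≋ → lincomb-injective (λ k → trans (lincomb-coordinates _ k) (x≋ k)))
                      , (λ {x} x≋ k → trans (lincomb-cong w x≋ k) (lincomb-coordinates x k))
          }
        ; to-linear = λ a u x → lincomb-injective (λ k → begin
            lincomb w (coordinates (a ·ᵥ u +ᵥ x)) k  ≈⟨ lincomb-coordinates _ k ⟩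
            a * u k + x k                            ≈⟨ sym (+-cong (*-congˡ (lincomb-coordinates u k))
                                                                    (lincomb-coordinates x k)) ⟩
            a * lincomb w (coordinates u) k + lincomb w (coordinates x) k
                                                     ≈⟨ sym (lincomb-linear w a _ _ k) ⟩
            lincomb w (a ·ᵥ coordinates u +ᵥ coordinates x) k ∎)
        }

      coordinates-basis : ∀ l → coordinates (w l) ≋ unit l
      coordinates-basis l = lincomb-injective (λ k → trans (lincomb-coordinates (w l) k) (sym (lincomb-unit w l k)))

    -- The relation -p₀ + Σ d_l p_{l+1} = 0 restricts to the spanning family
    -- obtained by deleting p_{l+1}; if d_l were 0 it would be a nontrivial
    -- relation there.
    circuit-coefficient≉0 : ∀ {m} (p : Fin (ℕ.suc m) → Vect F m) → (∀ i → Spans F (p ∘ punchIn i)) →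
      ∀ d → p zero ≋ lincomb (p ∘ suc) d → ∀ l → ¬ d l ≈ 0#
    circuit-coefficient≉0 {m} p spans d p₀≋ l dl≈0 = 1≉0 (begin
      1#              ≈⟨ sym (+-identityʳ 1#) ⟩
      1# + 0#         ≈⟨ +-congˡ (sym -1≈0) ⟩
      1# + - 1#       ≈⟨ -‿inverseʳ 1# ⟩
      0#              ∎)
      where
      e : Vect F (ℕ.suc m)
      e zero    = - 1#
      e (suc k) = d k

      relation : ∀ k → lincomb p e k ≈ 0#
      relation k = trans (+-cong (-1*x≈-x (p zero k)) (sym (p₀≋ k))) (-‿inverseˡ (p zero k))

      p′ : Fin m → Vect F m
      p′ = p ∘ punchIn (suc l)

      e′ : Vect F m
      e′ = e ∘ punchIn (suc l)

      restricted : lincomb p′ e′ ≋ lincomb p′ (λ _ → 0#)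
      restricted k = begin
        lincomb p′ e′ k                      ≈⟨ sym (+-identityˡ _) ⟩
        0# + lincomb p′ e′ k                 ≈⟨ +-congʳ (sym (trans (*-congʳ dl≈0) (zeroˡ (p (suc l) k)))) ⟩
        d l * p (suc l) k + lincomb p′ e′ k  ≈⟨ sym (sum-remove {i = suc l} (λ j → e j * p j k)) ⟩
        lincomb p e k                        ≈⟨ relation k ⟩
        0#                                   ≈⟨ sym (lincomb-zero p′ k) ⟩
        lincomb p′ (λ _ → 0#) k              ∎

      -1≈0 : - 1# ≈ 0#
      -1≈0 = ≡.subst (λ i → e i ≈ 0#) (punchIn-punchOut {i = suc l} {j = zero} λ ())
        (Coordinates.lincomb-injective p′ (spans (suc l)) restricted (punchOut {i = suc l} λ ()))

module ArcPartitions (F : Field) {q} (ψ : HasCardinality F q) {m r} (arc : Arc F m (m ℕ.+ r)) where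
  open Field F hiding (zero)
  open VectorSpace F
  open Finite ψ
  open Arc arc using (point; spanning)

  partition : Fin (m ℕ.+ r) → Partition (Fin (q ℕ.^ m))
  partition i = record
    { _∼_           = (λ x y → x ∼ y mod⟨ point i ⟩) on encode
    ; isEquivalence = On.isEquivalence encode (mod-isEquivalence (point i))
    }

  partition-transport : (L : LinearEquiv m) (i : Fin (m ℕ.+ r)) {S : Rel (Vect F m) 0ℓ} →
    (∀ {α β} → α ∼ β mod⟨ to L (point i) ⟩ ⇔ S α β) →
    SamePartition (Partition._∼_ (partition i)) (S on (to L ∘ encode))
  partition-transport L i mod⇔S x y = Equivalence.to x⇔y , Equivalence.from x⇔y
    where x⇔y = mod⇔S ⇔-∘ mod-transport L

  cartesian : ∀ (s : Choice m (m ℕ.+ r)) → IsCartesianMinimal m (λ l → Partition._∼_ (partition (proj₁ s l)))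
  cartesian (s , s-injective) = Fin q , Φ , (λ l → l , same l) , (λ l → l , same l)
    where
    open Coordinates (point ∘ s) (spanning (s , s-injective))

    Φ : Inverse (≡.setoid (Fin (q ℕ.^ m))) (≋-setoid (≡.setoid (Fin q)) m)
    Φ = Composition.inverse (Composition.inverse (encoding m) (LinearEquiv.iso coordinate-equiv))
          (pointwise-inverse m (Symmetry.inverse ψ))

    same : ∀ l → SamePartition (Partition._∼_ (partition (s l)))
                               (CartQ (Fin q) m l on Inverse.to Φ)
    same l = partition-transport coordinate-equiv (s l)
      (agreeOff⇔cartesian l ⇔-∘ (coordinateCoset⇔agreeOff l
        ⇔-∘ (mod-supported⇔coordinateCoset l (λ u≈0 → 1≉0 (trans (sym (unit-self l)) u≈0)) (unit-other l)
        ⇔-∘ mod-cong (coordinates-basis l))))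

  -- The first chosen point is sent to the all-ones vector, point l+1 to a
  -- multiple of the l-th unit vector.
  group : ∀ (t : Choice (ℕ.suc m) (m ℕ.+ r)) → DefinesGroup F m (λ l → Partition._∼_ (partition (proj₁ t l)))
  group (τ , τ-injective) = Composition.inverse (encoding m) (LinearEquiv.iso L) , (λ j → coset j , same j) , back
    where
    p : Fin (ℕ.suc m) → Vect F m
    p = point ∘ τ

    subfamilies-span : ∀ i → Spans F (p ∘ punchIn i)
    subfamilies-span i = spanning (τ ∘ punchIn i , punchIn-injective i _ _ ∘ τ-injective)

    open Coordinates (p ∘ suc) (subfamilies-span zero)

    d : Vect F m
    d = coordinates (p zero)

    d≉0 : ∀ l → ¬ d l ≈ 0#
    d≉0 = circuit-coefficient≉0 p subfamilies-span d (λ k → sym (lincomb-coordinates (p zero) k))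

    d⁻¹ : Vect F m
    d⁻¹ l = proj₁ (inverse (d l) (d≉0 l))

    d⁻¹d≈1 : ∀ l → d⁻¹ l * d l ≈ 1#
    d⁻¹d≈1 l = trans (*-comm _ _) (proj₂ (inverse (d l) (d≉0 l)))

    L : LinearEquiv m
    L = scaling d⁻¹ d d⁻¹d≈1 ∘ₗ coordinate-equiv

    coset : Fin (ℕ.suc m) → Fin m ⊎ ⊤
    coset zero    = inj₂ tt
    coset (suc l) = inj₁ l

    same : ∀ j → SamePartition (Partition._∼_ (partition (τ j)))
                               (RightCoset F m (coset j) on (to L ∘ encode))
    same zero    = partition-transport L (τ zero) (mod-ones⇔diagonalCoset d⁻¹d≈1)
    same (suc l) = partition-transport L (τ (suc l)) (mod-supported⇔coordinateCoset l Lpₗ≉0 Lpⱼ≈0)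
      where
      Lpₗ≉0 : ¬ d⁻¹ l * coordinates (p (suc l)) l ≈ 0#
      Lpₗ≉0 = invertible⇒≉0 (trans (*-congʳ (*-congˡ (trans (coordinates-basis l l) (unit-self l))))
                              (trans (*-congʳ (*-identityʳ (d⁻¹ l))) (d⁻¹d≈1 l)))

      Lpⱼ≈0 : ∀ j → ¬ j ≡ l → d⁻¹ j * coordinates (p (suc l)) j ≈ 0#
      Lpⱼ≈0 j j≢l = trans (*-congˡ (trans (coordinates-basis l j) (unit-other l j j≢l))) (zeroʳ (d⁻¹ j))

    back : ∀ j → ∃[ i ] SamePartition (Partition._∼_ (partition (τ i)))
                                      (RightCoset F m j on (to L ∘ encode))
    back (inj₁ l)  = suc l , same (suc l)
    back (inj₂ tt) = zero , same zero

open import Data.Nat using (_≤_; _+_)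

proposition5 : ∀ (q : ℕ) → IsPrimePower q →
    ∀ (F : Field) → HasCardinality F q →
    ∀ (m r : ℕ) → 2 ≤ m → 1 ≤ r →
    Arc F m (m + r) → TAtLeast F q m r
proposition5 q _ F ψ m r _ _ arc = r , ≤-refl , partition , cartesian , group
  where open ArcPartitions F ψ arc
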